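{- Fix $n\ge1$, ${\bf c}=(c_1,\dots,c_n)\in\mathbb{Z}^n_{>0}$ and ${\bf j}=(j_1,\dots,j_n)\in\mathbb{Z}^n_{\ge0}$. Then the flow polytope $\mathcal F_{G[{\bf j}+{\bf 1}]({\bf c})}(e_1-e_{n+2})$ admits a dissection into $$\frac{(c_1)_{j_1}}{j_1!}\cdots\frac{(c_n)_{j_n}}{j_n!}$$ unimodular simplices, where $(k)_j:=k(k+1)\cdots(k+j-1)$ (so $\frac{(c_i)_{j_i}}{j_i!}=\binom{c_i+j_i-1}{j_i}$).
   Context: $G[{\bf j}+{\bf 1}]({\bf c})$ is the directed multigraph on vertex set $\{0,1,\dots,n+1\}$ with exactly $c_i$ parallel edges $(0,i)$ and $j_i+1$ parallel edges $(i,n+1)$ for each $i\in[n]$, and no other edges. For a graph $H$ on this vertex set and ${\bf b}\in\mathbb{R}^{n+2}$ indexed by vertices $0,1,\dots,n+1$ in this order, $\mathcal F_H({\bf b})=\{f\in\mathbb{R}^{E(H)}_{\ge0}: M_Hf={\bf b}\}$, where $M_H$ has column $e_i-e_j$ for each edge $(i,j)$ (with multiplicity); thus $e_1-e_{n+2}$ means netflow $1$ at vertex $0$ and $-1$ at vertex $n+1$. A dissection of a polytope $P$ is a finite collection of polytopes of the same dimension as $P$, with pairwise disjoint relative interiors, whose union is $P$. A unimodular simplex is a lattice simplex of normalized volume $1$, where normalized volume assigns volume $1$ to the smallest simplex with vertices in the lattice $\mathbb{Z}^{E(H)}\cap\mathrm{aff}(P)$.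
   Formalization: Points of the flow polytope $\mathcal F_{G[{\bf j}+{\bf 1}]({\bf c})}(e_1-e_{n+2})$, and the points tested in the covering, affine-hull and relative-interior conditions of the dissection, have rational coordinates instead of real ones. -}

module Defs where

open import Data.Nat as ℕ using (ℕ; zero; suc; _!; NonZero)
open import Data.Nat.Properties using (_!≢0)
open import Data.Nat.DivMod using (_/_)
open import Data.Integer as ℤ using (ℤ)
open import Data.Rational as ℚ using (ℚ; 0ℚ; 1ℚ)
open import Data.Rational.Literals using (fromℤ)
open import Data.Fin as Fin using (Fin; zero; suc; fromℕ; inject₁; _≟_)
open import Data.List as List using (List; length; lookup; replicate; _++_; concatMap; allFin)
open import Data.Product using (Σ; ∃; ∃-syntax; _×_; _,_; proj₁; proj₂)
open import Data.Sum using (_⊎_)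
open import Relation.Nullary using (¬_; yes; no)
open import Relation.Binary.PropositionalEquality using (_≡_; _≢_)

sumℚ : ∀ {k} → (Fin k → ℚ) → ℚ
sumℚ {zero}  f = 0ℚ
sumℚ {suc k} f = f zero ℚ.+ sumℚ (λ i → f (suc i))

sumℤ : ∀ {k} → (Fin k → ℤ) → ℤ
sumℤ {zero}  f = ℤ.0ℤ
sumℤ {suc k} f = f zero ℤ.+ sumℤ (λ i → f (suc i))

prodℕ : ∀ {k} → (Fin k → ℕ) → ℕ
prodℕ {zero}  f = 1
prodℕ {suc k} f = f zero ℕ.* prodℕ (λ i → f (suc i))

rising : ℕ → ℕ → ℕ
rising k zero    = 1
rising k (suc j) = rising k j ℕ.* (k ℕ.+ j)

risingOverFact : ℕ → ℕ → ℕ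
risingOverFact k j = (rising k j / (j !)) {{j !≢0}}

-- Directed multigraphs on vertex set Fin V, as lists of edges (src , tgt)
-- (list positions distinguish parallel edges)

Graph : ℕ → Set
Graph V = List (Fin V × Fin V)

Edge : ∀ {V} → Graph V → Set
Edge H = Fin (length H)

src tgt : ∀ {V} (H : Graph V) → Edge H → Fin V
src H e = proj₁ (lookup H e)
tgt H e = proj₂ (lookup H e)

δ : ∀ {V} → Fin V → Fin V → ℚ
δ u v with u ≟ v
... | yes _ = 1ℚ
... | no  _ = 0ℚ

incidence : ∀ {V} (H : Graph V) → (Edge H → ℚ) → Fin V → ℚ
incidence H f v = sumℚ (λ e → f e ℚ.* (δ (src H e) v ℚ.- δ (tgt H e) v))

InFlowPolytope : ∀ {V} (H : Graph V) → (Fin V → ℚ) → (Edge H → ℚ) → Set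
InFlowPolytope H b f = (∀ e → 0ℚ ℚ.≤ f e) × (∀ v → incidence H f v ≡ b v)

-- The graph G[j+1](c) on vertices 0,1,...,n+1 (as Fin (n+2));
-- vertex i ∈ [n] is  suc (inject₁ i)  for i : Fin n, vertex n+1 is fromℕ (suc n)

G[j+1] : (n : ℕ) → (j c : Fin n → ℕ) → Graph (suc (suc n))
G[j+1] n j c = concatMap
  (λ i → replicate (c i) (zero , suc (inject₁ i))
      ++ replicate (suc (j i)) (suc (inject₁ i) , fromℕ (suc n)))
  (allFin n)

-- netflow vector e_1 - e_{n+2}: +1 at vertex 0, -1 at vertex n+1
e₁-eₙ₊₂ : (n : ℕ) → Fin (suc (suc n)) → ℚ
e₁-eₙ₊₂ n zero = 1ℚ
e₁-eₙ₊₂ n (suc v) with suc v ≟ fromℕ (suc n)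
... | yes _ = ℚ.- 1ℚ
... | no  _ = 0ℚ

LatticeSimplex : ℕ → ℕ → Set
LatticeSimplex m d = Fin (suc d) → (Fin m → ℤ)

comb : ∀ {m d} → LatticeSimplex m d → (Fin (suc d) → ℚ) → Fin m → ℚ
comb σ λ' x = sumℚ (λ k → λ' k ℚ.* fromℤ (σ k x))

combℤ : ∀ {m d} → LatticeSimplex m d → (Fin (suc d) → ℤ) → Fin m → ℤ
combℤ σ μ x = sumℤ (λ k → μ k ℤ.* σ k x)

AffinelyIndependent : ∀ {m d} → LatticeSimplex m d → Set
AffinelyIndependent {m} {d} σ =
  ∀ (λ' : Fin (suc d) → ℚ) → sumℚ λ' ≡ 0ℚ → (∀ x → comb σ λ' x ≡ 0ℚ) → ∀ k → λ' k ≡ 0ℚ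

InAff : ∀ {m d} → LatticeSimplex m d → (Fin m → ℚ) → Set
InAff {m} {d} σ p = ∃[ λ' ] (sumℚ λ' ≡ 1ℚ × (∀ x → comb σ λ' x ≡ p x))

InConv : ∀ {m d} → LatticeSimplex m d → (Fin m → ℚ) → Set
InConv {m} {d} σ p = ∃[ λ' ] ((∀ k → 0ℚ ℚ.≤ λ' k) × sumℚ λ' ≡ 1ℚ × (∀ x → comb σ λ' x ≡ p x))

InRelInt : ∀ {m d} → LatticeSimplex m d → (Fin m → ℚ) → Set
InRelInt {m} {d} σ p = ∃[ λ' ] ((∀ k → 0ℚ ℚ.< λ' k) × sumℚ λ' ≡ 1ℚ × (∀ x → comb σ λ' x ≡ p x))

-- normalized volume 1 w.r.t. the lattice ℤ^m ∩ aff(σ): the vertices affinely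
-- generate every lattice point of aff(σ)
Unimodular : ∀ {m d} → LatticeSimplex m d → Set
Unimodular {m} {d} σ =
  AffinelyIndependent σ ×
  (∀ (z : Fin m → ℤ) → InAff σ (λ x → fromℤ (z x)) →
     ∃[ μ ] (sumℤ μ ≡ ℤ.1ℤ × (∀ x → combℤ σ μ x ≡ z x)))

-- Dissection of the polytope P = {p | InP p} (rational points) into the
-- simplices of a list (positions = members of the collection)

record IsDissection {m d : ℕ} (InP : (Fin m → ℚ) → Set)
                    (S : List (LatticeSimplex m d)) : Set₁ where
  field
    affIndep   : ∀ s → AffinelyIndependent (lookup S s)
    vertsInP   : ∀ s k → InP (λ x → fromℤ (lookup S s k x))
    -- each piece has the same dimension as P: aff(P) ⊆ aff(piece)
    fullDim    : ∀ s p → InP p → InAff (lookup S s) p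
    covers     : ∀ p → InP p → ∃[ s ] InConv (lookup S s) p
    disjoint   : ∀ s t → s ≢ t → ∀ p →
                 ¬ (InRelInt (lookup S s) p × InRelInt (lookup S t) p)

{-# OPTIONS --safe #-}
-- A flow with netflow e₁ - e_{n+2} on G[j+1](c) is a convex combination, over the middle vertices i, of
-- pairs (x_i , y_i) of nonnegative vectors on the c_i in-edges and j_i + 1 out-edges of i with equal
-- sums; so the flow polytope is the join of the products Δ_{c_i - 1} × Δ_{j_i}. Each product carries the
-- staircase triangulation, whose simplices are the monotone lattice paths from (0,0) to (c_i - 1, j_i).
-- The barycentric coordinates of (x , y) in the simplex of a path are given by the northwest-corner
-- rule of transportation theory, which is integral on integral data (unimodularity), nonnegative for
-- at least one path (covering) and positive for at most one (disjoint interiors). Joining one simplex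
-- per block gives a dissection indexed by tuples of paths, of which there are
-- ∏ C(c_i + j_i - 1, j_i) = ∏ (c_i)_{j_i} / j_i!.
module Submission where

open import Defs
open import Function using (_∘_; id; const)
open import Data.Nat as ℕ using (ℕ; zero; suc; _!)
import Data.Nat.Properties as ℕₚ
open import Data.Integer as ℤ using (ℤ)
open import Data.Rational using (ℚ; 0ℚ; 1ℚ)
import Data.Rational.Properties as ℚₚ
open import Data.Rational.Literals using (fromℤ)
open import Data.Fin as Fin using (Fin; zero; suc; _↑ˡ_; _↑ʳ_; splitAt; inject₁; fromℕ; _≟_)
import Data.Fin.Properties as Finₚ
open import Data.List using (List; length; lookup)
open import Data.Product using (Σ-syntax; ∃-syntax; _×_; _,_; proj₁; proj₂)
open import Data.Sum using (_⊎_; inj₁; inj₂)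
open import Data.Empty using (⊥-elim)
open import Relation.Nullary using (¬_; yes; no)
open import Relation.Binary.PropositionalEquality

UnimodularDissection : (n : ℕ) → Graph (suc (suc n)) → ℕ → Set₁
UnimodularDissection n H N = ∃[ d ] ∃[ S ] (IsDissection {length H} {d} (InFlowPolytope H (e₁-eₙ₊₂ n)) S
                                           × (∀ s → Unimodular (lookup S s))
                                           × length S ≡ N)

module RationalSums where

  open import Data.Rational using (_+_; _-_; _*_; -_; _≤_)
  import Data.Rational.Unnormalised as ℚᵘ
  import Data.Rational.Unnormalised.Properties as ℚᵘₚ
  import Data.Integer.Properties as ℤₚ

  sumℚ-cong : ∀ {k} {f g : Fin k → ℚ} → f ≗ g → sumℚ f ≡ sumℚ g
  sumℚ-cong {zero}  f≗g = refl
  sumℚ-cong {suc k} f≗g = cong₂ _+_ (f≗g zero) (sumℚ-cong (f≗g ∘ suc))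

  sumℚ-zero : ∀ {k} {f : Fin k → ℚ} → f ≗ const 0ℚ → sumℚ f ≡ 0ℚ
  sumℚ-zero {zero}  f≗0 = refl
  sumℚ-zero {suc k} f≗0 = trans (cong₂ _+_ (f≗0 zero) (sumℚ-zero (f≗0 ∘ suc))) (ℚₚ.+-identityʳ 0ℚ)

  sumℚ-*ʳ : ∀ {k} (f : Fin k → ℚ) c → sumℚ (λ i → f i * c) ≡ sumℚ f * c
  sumℚ-*ʳ {zero}  f c = sym (ℚₚ.*-zeroˡ c)
  sumℚ-*ʳ {suc k} f c = trans (cong (f zero * c +_) (sumℚ-*ʳ (f ∘ suc) c))
                              (sym (ℚₚ.*-distribʳ-+ c (f zero) _))

  sumℚ-neg : ∀ {k} (f : Fin k → ℚ) → sumℚ (λ i → - f i) ≡ - sumℚ f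
  sumℚ-neg {zero}  f = refl
  sumℚ-neg {suc k} f = trans (cong (- f zero +_) (sumℚ-neg (f ∘ suc)))
                             (sym (ℚₚ.neg-distrib-+ (f zero) _))

  sumℚ-single : ∀ {k} (f : Fin k → ℚ) i₀ → (∀ i → i ≢ i₀ → f i ≡ 0ℚ) → sumℚ f ≡ f i₀
  sumℚ-single {suc k} f zero f≡0 =
    trans (cong (f zero +_) (sumℚ-zero (λ i → f≡0 (suc i) λ ()))) (ℚₚ.+-identityʳ _)
  sumℚ-single {suc k} f (suc i₀) f≡0 =
    trans (cong₂ _+_ (f≡0 zero λ ())
                     (sumℚ-single (f ∘ suc) i₀ λ i i≢i₀ → f≡0 (suc i) (i≢i₀ ∘ Finₚ.suc-injective)))
          (ℚₚ.+-identityˡ _)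

  sumℚ-nonneg : ∀ {k} (f : Fin k → ℚ) → (∀ i → 0ℚ ≤ f i) → 0ℚ ≤ sumℚ f
  sumℚ-nonneg {zero}  f f≥0 = ℚₚ.≤-refl
  sumℚ-nonneg {suc k} f f≥0 = ℚₚ.+-mono-≤ (f≥0 zero) (sumℚ-nonneg (f ∘ suc) (f≥0 ∘ suc))

  sumℚ-splitAt : ∀ m {n} (f : Fin (m ℕ.+ n) → ℚ) →
                 sumℚ f ≡ sumℚ (f ∘ (_↑ˡ n)) + sumℚ (f ∘ (m ↑ʳ_))
  sumℚ-splitAt zero    f = sym (ℚₚ.+-identityˡ _)
  sumℚ-splitAt (suc m) f = trans (cong (f zero +_) (sumℚ-splitAt m (f ∘ suc))) (sym (ℚₚ.+-assoc (f zero) _ _))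

  fromℤ-injective : ∀ {a b} → fromℤ a ≡ fromℤ b → a ≡ b
  fromℤ-injective = cong ℚ.numerator

  fromℤ-+ : ∀ a b → fromℤ (a ℤ.+ b) ≡ fromℤ a + fromℤ b
  fromℤ-+ a b = ℚₚ.toℚᵘ-injective
    (ℚᵘₚ.≃-trans (ℚᵘ.*≡* (cong (ℤ._* ℤ.1ℤ) (cong₂ ℤ._+_ (sym (ℤₚ.*-identityʳ a))
                                                         (sym (ℤₚ.*-identityʳ b)))))
                 (ℚᵘₚ.≃-sym (ℚₚ.toℚᵘ-homo-+ (fromℤ a) (fromℤ b))))

  fromℤ-* : ∀ a b → fromℤ (a ℤ.* b) ≡ fromℤ a * fromℤ b
  fromℤ-* a b = ℚₚ.toℚᵘ-injective
    (ℚᵘₚ.≃-trans (ℚᵘ.*≡* refl) (ℚᵘₚ.≃-sym (ℚₚ.toℚᵘ-homo-* (fromℤ a) (fromℤ b))))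

  fromℤ-neg : ∀ a → fromℤ (ℤ.- a) ≡ - fromℤ a
  fromℤ-neg a = ℚₚ.toℚᵘ-injective
    (ℚᵘₚ.≃-trans (ℚᵘ.*≡* refl) (ℚᵘₚ.≃-sym (ℚₚ.toℚᵘ-homo‿- (fromℤ a))))

  fromℤ-sumℤ : ∀ {k} (f : Fin k → ℤ) → fromℤ (sumℤ f) ≡ sumℚ (fromℤ ∘ f)
  fromℤ-sumℤ {zero}  f = refl
  fromℤ-sumℤ {suc k} f = trans (fromℤ-+ (f zero) _) (cong (fromℤ (f zero) +_) (fromℤ-sumℤ (f ∘ suc)))

  δ-refl : ∀ {m} (u : Fin m) → δ u u ≡ 1ℚ
  δ-refl u with u ≟ u
  ... | yes _   = refl
  ... | no  u≢u = ⊥-elim (u≢u refl)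

  δ-≢ : ∀ {m} {u v : Fin m} → u ≢ v → δ u v ≡ 0ℚ
  δ-≢ {u = u} {v} u≢v with u ≟ v
  ... | yes u≡v = ⊥-elim (u≢v u≡v)
  ... | no  _   = refl

  sum-δ : ∀ {m} (v : Fin m) → sumℚ (δ v) ≡ 1ℚ
  sum-δ v = trans (sumℚ-single (δ v) v λ w w≢v → δ-≢ (w≢v ∘ sym)) (δ-refl v)

  Integral : ℚ → Set
  Integral q = ∃[ z ] q ≡ fromℤ z

  integral-- : ∀ {p q} → Integral p → Integral q → Integral (p - q)
  integral-- (a , refl) (b , refl) = a ℤ.- b , sym (trans (fromℤ-+ a (ℤ.- b)) (cong (fromℤ a +_) (fromℤ-neg b)))

module Blocks where

  open RationalSums
  open import Data.Rational using (_+_)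
  open import Data.List using ([]; _∷_; _++_; concatMap; tabulate)
  import Data.Sum as Sum

  sumℕ : ∀ {n} → (Fin n → ℕ) → ℕ
  sumℕ {zero}  s = 0
  sumℕ {suc n} s = s zero ℕ.+ sumℕ (s ∘ suc)

  embedBlock : ∀ {n} (s : Fin n → ℕ) (i : Fin n) → Fin (s i) → Fin (sumℕ s)
  embedBlock {suc n} s zero    r = r ↑ˡ sumℕ (s ∘ suc)
  embedBlock {suc n} s (suc i) r = s zero ↑ʳ embedBlock (s ∘ suc) i r

  splitBlocks : ∀ {n} (s : Fin n → ℕ) → Fin (sumℕ s) → Σ[ i ∈ Fin n ] Fin (s i)
  splitBlocks {suc n} s v = Sum.[ (λ r → zero , r) , (λ w → let i , r = splitBlocks (s ∘ suc) w in suc i , r) ]′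
                                 (splitAt (s zero) v)

  splitBlocks-embedBlock : ∀ {n} (s : Fin n → ℕ) i r → splitBlocks s (embedBlock s i r) ≡ (i , r)
  splitBlocks-embedBlock {suc n} s zero    r rewrite Finₚ.splitAt-↑ˡ (s zero) r (sumℕ (s ∘ suc)) = refl
  splitBlocks-embedBlock {suc n} s (suc i) r
    rewrite Finₚ.splitAt-↑ʳ (s zero) (sumℕ (s ∘ suc)) (embedBlock (s ∘ suc) i r)
          | splitBlocks-embedBlock (s ∘ suc) i r = refl

  embedBlock-splitBlocks : ∀ {n} (s : Fin n → ℕ) v → let i , r = splitBlocks s v in embedBlock s i r ≡ v
  embedBlock-splitBlocks {suc n} s v with splitAt (s zero) v | Finₚ.join-splitAt (s zero) (sumℕ (s ∘ suc)) v
  ... | inj₁ r | eq = eq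
  ... | inj₂ w | eq = trans (cong (s zero ↑ʳ_) (embedBlock-splitBlocks (s ∘ suc) w)) eq

  sumℚ-blocks : ∀ {n} (s : Fin n → ℕ) (f : Fin (sumℕ s) → ℚ) →
                sumℚ f ≡ sumℚ (λ i → sumℚ (f ∘ embedBlock s i))
  sumℚ-blocks {zero}  s f = refl
  sumℚ-blocks {suc n} s f = trans (sumℚ-splitAt (s zero) f) (cong (sumℚ (f ∘ (_↑ˡ sumℕ (s ∘ suc))) +_)
                                  (sumℚ-blocks (s ∘ suc) (f ∘ (s zero ↑ʳ_))))

  sumℚ-cast : ∀ {m n} .(eq : m ≡ n) (f : Fin n → ℚ) → sumℚ f ≡ sumℚ (f ∘ Fin.cast eq)
  sumℚ-cast {zero}  {zero}  eq f = refl
  sumℚ-cast {suc m} {suc n} eq f = cong (f zero +_) (sumℚ-cast (ℕₚ.suc-injective eq) (f ∘ suc))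

  module _ {A : Set} where

    inˡ : ∀ (xs ys : List A) → Fin (length xs) → Fin (length (xs ++ ys))
    inˡ (x ∷ xs) ys zero    = zero
    inˡ (x ∷ xs) ys (suc p) = suc (inˡ xs ys p)

    inʳ : ∀ (xs ys : List A) → Fin (length ys) → Fin (length (xs ++ ys))
    inʳ []       ys q = q
    inʳ (x ∷ xs) ys q = suc (inʳ xs ys q)

    side : ∀ (xs ys : List A) → Fin (length (xs ++ ys)) → Fin (length xs) ⊎ Fin (length ys)
    side []       ys e       = inj₂ e
    side (x ∷ xs) ys zero    = inj₁ zero
    side (x ∷ xs) ys (suc e) = Sum.map₁ suc (side xs ys e)

    side-inˡ : ∀ xs ys p → side xs ys (inˡ xs ys p) ≡ inj₁ p
    side-inˡ (x ∷ xs) ys zero    = refl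
    side-inˡ (x ∷ xs) ys (suc p) = cong (Sum.map₁ suc) (side-inˡ xs ys p)

    side-inʳ : ∀ xs ys q → side xs ys (inʳ xs ys q) ≡ inj₂ q
    side-inʳ []       ys q = refl
    side-inʳ (x ∷ xs) ys q = cong (Sum.map₁ suc) (side-inʳ xs ys q)

    in-side : ∀ xs ys e → Sum.[ inˡ xs ys , inʳ xs ys ] (side xs ys e) ≡ e
    in-side []       ys e       = refl
    in-side (x ∷ xs) ys zero    = refl
    in-side (x ∷ xs) ys (suc e) with side xs ys e | in-side xs ys e
    ... | inj₁ p | eq = cong suc eq
    ... | inj₂ q | eq = cong suc eq

    lookup-inˡ : ∀ xs ys p → lookup (xs ++ ys) (inˡ xs ys p) ≡ lookup xs p
    lookup-inˡ (x ∷ xs) ys zero    = refl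
    lookup-inˡ (x ∷ xs) ys (suc p) = lookup-inˡ xs ys p

    lookup-inʳ : ∀ xs ys q → lookup (xs ++ ys) (inʳ xs ys q) ≡ lookup ys q
    lookup-inʳ []       ys q = refl
    lookup-inʳ (x ∷ xs) ys q = lookup-inʳ xs ys q

    sumℚ-++ : ∀ xs ys (f : Fin (length (xs ++ ys)) → ℚ) → sumℚ f ≡ sumℚ (f ∘ inˡ xs ys) + sumℚ (f ∘ inʳ xs ys)
    sumℚ-++ []       ys f = sym (ℚₚ.+-identityˡ _)
    sumℚ-++ (x ∷ xs) ys f = trans (cong (f zero +_) (sumℚ-++ xs ys (f ∘ suc))) (sym (ℚₚ.+-assoc (f zero) _ _))

    concatBlocks : ∀ {n} → (Fin n → List A) → List A
    concatBlocks {zero}  F = []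
    concatBlocks {suc n} F = F zero ++ concatBlocks (F ∘ suc)

    concatMap-tabulate : ∀ {B : Set} {n} (f : B → List A) (g : Fin n → B) →
                         concatMap f (tabulate g) ≡ concatBlocks (f ∘ g)
    concatMap-tabulate {n = zero}  f g = refl
    concatMap-tabulate {n = suc n} f g = cong (f (g zero) ++_) (concatMap-tabulate f (g ∘ suc))

    embedConcat : ∀ {n} (F : Fin n → List A) (i : Fin n) → Fin (length (F i)) → Fin (length (concatBlocks F))
    embedConcat {suc n} F zero    p = inˡ (F zero) _ p
    embedConcat {suc n} F (suc i) p = inʳ (F zero) _ (embedConcat (F ∘ suc) i p)

    splitConcat : ∀ {n} (F : Fin n → List A) → Fin (length (concatBlocks F)) → Σ[ i ∈ Fin n ] Fin (length (F i))
    splitConcat {suc n} F e = Sum.[ (λ p → zero , p) , (λ e′ → let i , p = splitConcat (F ∘ suc) e′ in suc i , p) ]′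
                                   (side (F zero) _ e)

    splitConcat-embedConcat : ∀ {n} (F : Fin n → List A) i p → splitConcat F (embedConcat F i p) ≡ (i , p)
    splitConcat-embedConcat {suc n} F zero    p rewrite side-inˡ (F zero) (concatBlocks (F ∘ suc)) p = refl
    splitConcat-embedConcat {suc n} F (suc i) p
      rewrite side-inʳ (F zero) (concatBlocks (F ∘ suc)) (embedConcat (F ∘ suc) i p)
            | splitConcat-embedConcat (F ∘ suc) i p = refl

    embedConcat-splitConcat : ∀ {n} (F : Fin n → List A) e → let i , p = splitConcat F e in embedConcat F i p ≡ e
    embedConcat-splitConcat {suc n} F e with side (F zero) (concatBlocks (F ∘ suc)) e | in-side (F zero) (concatBlocks (F ∘ suc)) e
    ... | inj₁ p  | eq = eq
    ... | inj₂ e′ | eq = trans (cong (inʳ (F zero) _) (embedConcat-splitConcat (F ∘ suc) e′)) eq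

    lookup-embedConcat : ∀ {n} (F : Fin n → List A) i p → lookup (concatBlocks F) (embedConcat F i p) ≡ lookup (F i) p
    lookup-embedConcat {suc n} F zero    p = lookup-inˡ (F zero) _ p
    lookup-embedConcat {suc n} F (suc i) p = trans (lookup-inʳ (F zero) _ _) (lookup-embedConcat (F ∘ suc) i p)

    sumℚ-concat : ∀ {n} (F : Fin n → List A) (f : Fin (length (concatBlocks F)) → ℚ) →
                  sumℚ f ≡ sumℚ (λ i → sumℚ (f ∘ embedConcat F i))
    sumℚ-concat {zero}  F f = refl
    sumℚ-concat {suc n} F f = trans (sumℚ-++ (F zero) _ f)
      (cong (sumℚ (f ∘ inˡ (F zero) _) +_) (sumℚ-concat (F ∘ suc) (f ∘ inʳ (F zero) _)))

module Tuples where

  open import Data.Nat using (_+_; _*_)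
  open import Data.Unit using (⊤; tt)
  open import Data.List using ([]; _∷_; _++_; map; cartesianProduct)
  import Data.List.Properties as Listₚ
  open import Data.List.Membership.Propositional using (_∈_)
  open import Data.List.Membership.Propositional.Properties using (∈-cartesianProduct⁺; ∈-lookup)
  open import Data.List.Relation.Unary.Any using (here)
  open import Data.List.Relation.Unary.All as All using ([])
  open import Data.List.Relation.Unary.AllPairs using ([]; _∷_)
  open import Data.List.Relation.Unary.Unique.Propositional using (Unique)
  import Data.List.Relation.Unary.Unique.Propositional.Properties as Uniqueₚ

  length-cartesianProduct : ∀ {A B : Set} (xs : List A) (ys : List B) →
                            length (cartesianProduct xs ys) ≡ length xs * length ys
  length-cartesianProduct []       ys = refl
  length-cartesianProduct (x ∷ xs) ys = trans (Listₚ.length-++ (map (x ,_) ys))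
    (cong₂ _+_ (Listₚ.length-map (x ,_) ys) (length-cartesianProduct xs ys))

  lookup-map : ∀ {A B : Set} (f : A → B) xs i → lookup (map f xs) i ≡ f (lookup xs (Fin.cast (Listₚ.length-map f xs) i))
  lookup-map f (x ∷ xs) zero    = refl
  lookup-map f (x ∷ xs) (suc i) = lookup-map f xs i

  lookup-injective : ∀ {A : Set} {xs : List A} → Unique xs → ∀ i j → lookup xs i ≡ lookup xs j → i ≡ j
  lookup-injective {xs = x ∷ xs} u          zero    zero    eq = refl
  lookup-injective {xs = x ∷ xs} (x∉ ∷ u)   zero    (suc j) eq = ⊥-elim (All.lookup x∉ (∈-lookup j) eq)
  lookup-injective {xs = x ∷ xs} (x∉ ∷ u)   (suc i) zero    eq = ⊥-elim (All.lookup x∉ (∈-lookup i) (sym eq))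
  lookup-injective {xs = x ∷ xs} (x∉ ∷ u)   (suc i) (suc j) eq = cong suc (lookup-injective u i j eq)

  Tuple : ∀ n → (Fin n → Set) → Set
  Tuple zero    P = ⊤
  Tuple (suc n) P = P zero × Tuple n (P ∘ suc)

  component : ∀ {n} {P : Fin n → Set} → Tuple n P → (i : Fin n) → P i
  component {suc n} (t₀ , t) zero    = t₀
  component {suc n} (t₀ , t) (suc i) = component t i

  tabulateTuple : ∀ {n} {P : Fin n → Set} → ((i : Fin n) → P i) → Tuple n P
  tabulateTuple {zero}  f = tt
  tabulateTuple {suc n} f = f zero , tabulateTuple (f ∘ suc)

  component-tabulate : ∀ {n} {P : Fin n → Set} (f : (i : Fin n) → P i) i → component (tabulateTuple f) i ≡ f i
  component-tabulate {suc n} f zero    = refl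
  component-tabulate {suc n} f (suc i) = component-tabulate (f ∘ suc) i

  Tuple-ext : ∀ {n} {P : Fin n → Set} {t t′ : Tuple n P} → (∀ i → component t i ≡ component t′ i) → t ≡ t′
  Tuple-ext {zero}  eq = refl
  Tuple-ext {suc n} eq = cong₂ _,_ (eq zero) (Tuple-ext (eq ∘ suc))

  tuples : ∀ {n} {P : Fin n → Set} → (∀ i → List (P i)) → List (Tuple n P)
  tuples {zero}  xs = tt ∷ []
  tuples {suc n} xs = cartesianProduct (xs zero) (tuples (xs ∘ suc))

  tuples-complete : ∀ {n} {P : Fin n → Set} {xs : ∀ i → List (P i)} (t : Tuple n P) →
                    (∀ i → component t i ∈ xs i) → t ∈ tuples xs
  tuples-complete {zero}  tt       ∈xs = here refl
  tuples-complete {suc n} (t₀ , t) ∈xs = ∈-cartesianProduct⁺ (∈xs zero) (tuples-complete t (∈xs ∘ suc))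

  tuples-unique : ∀ {n} {P : Fin n → Set} {xs : ∀ i → List (P i)} → (∀ i → Unique (xs i)) → Unique (tuples xs)
  tuples-unique {zero}  u = [] ∷ []
  tuples-unique {suc n} u = Uniqueₚ.cartesianProduct⁺ (u zero) (tuples-unique (u ∘ suc))

  prodℕ-cong : ∀ {k} {f g : Fin k → ℕ} → f ≗ g → prodℕ f ≡ prodℕ g
  prodℕ-cong {zero}  f≗g = refl
  prodℕ-cong {suc k} f≗g = cong₂ _*_ (f≗g zero) (prodℕ-cong (f≗g ∘ suc))

  length-tuples : ∀ {n} {P : Fin n → Set} (xs : ∀ i → List (P i)) → length (tuples xs) ≡ prodℕ (length ∘ xs)
  length-tuples {zero}  xs = refl
  length-tuples {suc n} xs = trans (length-cartesianProduct (xs zero) _) (cong (length (xs zero) *_) (length-tuples (xs ∘ suc)))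

module Staircase where

  open RationalSums
  open import Data.Rational using (_+_; _-_; -_; _*_; _≤_; _<_)
  open import Data.Rational.Solver using (module +-*-Solver)
  open +-*-Solver
  open import Data.Bool using (true; false; if_then_else_)
  open import Relation.Nullary using (does)
  open import Data.Vec.Functional using (head; tail; _∷_; updateAt)

  δℤ : ∀ {m} → Fin m → Fin m → ℤ
  δℤ p q = if does (p ≟ q) then ℤ.1ℤ else ℤ.0ℤ

  δℤ-nonneg : ∀ {m} (p q : Fin m) → 0ℚ ≤ fromℤ (δℤ p q)
  δℤ-nonneg p q with does (p ≟ q)
  ... | true  = ℚₚ.nonNegative⁻¹ 1ℚ
  ... | false = ℚₚ.≤-refl

  -- A monotone lattice path from (0,0) to (a,b) in k steps, listed from (0,0); its nodes (col r, row r)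
  -- are the vertices of a maximal simplex of the staircase triangulation of Δ_a × Δ_b.
  data Staircase : ℕ → ℕ → ℕ → Set where
    corner : Staircase 0 0 0
    right  : ∀ {a b k} → Staircase a b k → Staircase (suc a) b (suc k)
    up     : ∀ {a b k} → Staircase a b k → Staircase a (suc b) (suc k)

  col : ∀ {a b k} → Staircase a b k → Fin (suc k) → Fin (suc a)
  col corner    = const zero
  col (right π) = zero ∷ (suc ∘ col π)
  col (up π)    = zero ∷ col π

  row : ∀ {a b k} → Staircase a b k → Fin (suc k) → Fin (suc b)
  row corner    = const zero
  row (right π) = zero ∷ row π
  row (up π)    = zero ∷ (suc ∘ row π)

  -- The northwest-corner rule: a node followed by a right step exhausts the mass x₀ of its column and
  -- leaves y₀ - x₀ in its row (dually for up). These are the barycentric coordinates of (x , y).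
  northWest : ∀ {a b k} → Staircase a b k → (Fin (suc a) → ℚ) → (Fin (suc b) → ℚ) → Fin (suc k) → ℚ
  northWest corner    x y = x
  northWest (right π) x y = head x ∷ northWest π (tail x) (updateAt y zero (_- head x))
  northWest (up π)    x y = head y ∷ northWest π (updateAt x zero (_- head y)) (tail y)

  marginalˣ : ∀ {a b k} → Staircase a b k → (Fin (suc k) → ℚ) → Fin (suc a) → ℚ
  marginalˣ π μ p = sumℚ (λ r → μ r * fromℤ (δℤ (col π r) p))

  marginalʸ : ∀ {a b k} → Staircase a b k → (Fin (suc k) → ℚ) → Fin (suc b) → ℚ
  marginalʸ π μ q = sumℚ (λ r → μ r * fromℤ (δℤ (row π r) q))

  marginalˣ-cong : ∀ {a b k} (π : Staircase a b k) {μ ν} → μ ≗ ν → marginalˣ π μ ≗ marginalˣ π ν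
  marginalˣ-cong π μ≗ν p = sumℚ-cong (λ r → cong (_* fromℤ (δℤ (col π r) p)) (μ≗ν r))

  marginalʸ-cong : ∀ {a b k} (π : Staircase a b k) {μ ν} → μ ≗ ν → marginalʸ π μ ≗ marginalʸ π ν
  marginalʸ-cong π μ≗ν q = sumℚ-cong (λ r → cong (_* fromℤ (δℤ (row π r) q)) (μ≗ν r))

  Balanced : ∀ {a b} → (Fin a → ℚ) → (Fin b → ℚ) → Set
  Balanced x y = sumℚ x ≡ sumℚ y

  private
    first-only : ∀ {k} (μ : Fin (suc k) → ℚ) → head μ * 1ℚ + sumℚ (λ r → tail μ r * 0ℚ) ≡ head μ
    first-only μ = trans (cong (head μ * 1ℚ +_) (sumℚ-zero (λ r → ℚₚ.*-zeroʳ (tail μ r))))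
                         (solve 1 (λ m → m :* con 1ℚ :+ con 0ℚ := m) refl (head μ))

    first-absent : ∀ m s → m * 0ℚ + s ≡ s
    first-absent = solve 2 (λ m s → m :* con 0ℚ :+ s := s) refl

    first-added : ∀ m s → m * 1ℚ + s ≡ m + s
    first-added = solve 2 (λ m s → m :* con 1ℚ :+ s := m :+ s) refl

  marginalˣ-corner : ∀ μ → marginalˣ corner μ zero ≡ head μ
  marginalˣ-corner = first-only

  marginalʸ-corner : ∀ μ → marginalʸ corner μ zero ≡ head μ
  marginalʸ-corner = first-only

  marginalˣ-right : ∀ {a b k} (π : Staircase a b k) μ → marginalˣ (right π) μ ≗ head μ ∷ marginalˣ π (tail μ)
  marginalˣ-right π μ zero    = first-only μ
  marginalˣ-right π μ (suc p) = first-absent (head μ) _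

  marginalʸ-right : ∀ {a b k} (π : Staircase a b k) μ →
                    marginalʸ (right π) μ ≗ updateAt (marginalʸ π (tail μ)) zero (head μ +_)
  marginalʸ-right π μ zero    = first-added (head μ) _
  marginalʸ-right π μ (suc q) = first-absent (head μ) _

  marginalʸ-up : ∀ {a b k} (π : Staircase a b k) μ → marginalʸ (up π) μ ≗ head μ ∷ marginalʸ π (tail μ)
  marginalʸ-up π μ zero    = first-only μ
  marginalʸ-up π μ (suc q) = first-absent (head μ) _

  marginalˣ-up : ∀ {a b k} (π : Staircase a b k) μ →
                 marginalˣ (up π) μ ≗ updateAt (marginalˣ π (tail μ)) zero (head μ +_)
  marginalˣ-up π μ zero    = first-added (head μ) _
  marginalˣ-up π μ (suc p) = first-absent (head μ) _

  updateAt-cong : ∀ {m} {f g : Fin (suc m) → ℚ} {c d} → f ≗ g → c ≡ d →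
                  updateAt f zero (_- c) ≗ updateAt g zero (_- d)
  updateAt-cong f≗g c≡d zero    = cong₂ _-_ (f≗g zero) c≡d
  updateAt-cong f≗g c≡d (suc q) = f≗g (suc q)

  updateAt-+-− : ∀ {m} {f g : Fin (suc m) → ℚ} {c d} → f ≗ updateAt g zero (c +_) → d ≡ c →
                 updateAt f zero (_- d) ≗ g
  updateAt-+-− {g = g} {c} f≗ refl zero = trans (cong (_- c) (f≗ zero)) (solve 2 (λ c g → (c :+ g) :- c := g) refl c (g zero))
  updateAt-+-− f≗ d≡c (suc q) = f≗ (suc q)

  updateAt-−-+ : ∀ {m} {f g : Fin (suc m) → ℚ} {c} → f ≗ updateAt g zero (_- c) → updateAt f zero (c +_) ≗ g
  updateAt-−-+ {g = g} {c} f≗ zero    = trans (cong (c +_) (f≗ zero)) (solve 2 (λ c g → c :+ (g :- c) := g) refl c (g zero))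
  updateAt-−-+ f≗ (suc q) = f≗ (suc q)

  balanced-right : ∀ {a b} {x : Fin (suc (suc a)) → ℚ} {y : Fin (suc b) → ℚ} →
                   Balanced x y → Balanced (tail x) (updateAt y zero (_- head x))
  balanced-right {x = x} {y} bal = begin
    sumℚ (tail x)                          ≡⟨ solve 2 (λ h s → s := (h :+ s) :- h) refl (head x) _ ⟩
    sumℚ x - head x                        ≡⟨ cong (_- head x) bal ⟩
    sumℚ y - head x                        ≡⟨ solve 3 (λ h y₀ s → (y₀ :+ s) :- h := (y₀ :- h) :+ s)
                                                       refl (head x) (head y) _ ⟩
    sumℚ (updateAt y zero (_- head x))     ∎
    where open ≡-Reasoning

  balanced-singleton : {x y : Fin 1 → ℚ} → Balanced x y → head x ≡ head y
  balanced-singleton bal = trans (sym (ℚₚ.+-identityʳ _)) (trans bal (ℚₚ.+-identityʳ _))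

  balanced-up : ∀ {a b} {x : Fin (suc a) → ℚ} {y : Fin (suc (suc b)) → ℚ} →
                Balanced x y → Balanced (updateAt x zero (_- head y)) (tail y)
  balanced-up {x = x} {y} bal = sym (balanced-right {x = y} {x} (sym bal))

  northWest-cong : ∀ {a b k} (π : Staircase a b k) {x x′ y y′} → x ≗ x′ → y ≗ y′ →
                   northWest π x y ≗ northWest π x′ y′
  northWest-cong corner    x≗ y≗ = x≗
  northWest-cong (right π) x≗ y≗ zero    = x≗ zero
  northWest-cong (right π) x≗ y≗ (suc r) = northWest-cong π (x≗ ∘ suc) (updateAt-cong y≗ (x≗ zero)) r
  northWest-cong (up π)    x≗ y≗ zero    = y≗ zero
  northWest-cong (up π)    x≗ y≗ (suc r) = northWest-cong π (updateAt-cong x≗ (y≗ zero)) (y≗ ∘ suc) r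

  northWest-zero : ∀ {a b k} (π : Staircase a b k) → northWest π (const 0ℚ) (const 0ℚ) ≗ const 0ℚ
  northWest-zero corner    r       = refl
  northWest-zero (right π) zero    = refl
  northWest-zero (right π) (suc r) = trans (northWest-cong π (λ _ → refl) (λ { zero → refl ; (suc q) → refl }) r)
                                           (northWest-zero π r)
  northWest-zero (up π)    zero    = refl
  northWest-zero (up π)    (suc r) = trans (northWest-cong π (λ { zero → refl ; (suc p) → refl }) (λ _ → refl) r)
                                           (northWest-zero π r)

  northWest-marginals : ∀ {a b k} (π : Staircase a b k) μ → northWest π (marginalˣ π μ) (marginalʸ π μ) ≗ μ
  northWest-marginals corner    μ zero    = marginalˣ-corner μ
  northWest-marginals (right π) μ zero    = marginalˣ-right π μ zero
  northWest-marginals (right π) μ (suc r) =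
    trans (northWest-cong π (marginalˣ-right π μ ∘ suc) (updateAt-+-− (marginalʸ-right π μ) (marginalˣ-right π μ zero)) r)
          (northWest-marginals π (tail μ) r)
  northWest-marginals (up π)    μ zero    = marginalʸ-up π μ zero
  northWest-marginals (up π)    μ (suc r) =
    trans (northWest-cong π (updateAt-+-− (marginalˣ-up π μ) (marginalʸ-up π μ zero)) (marginalʸ-up π μ ∘ suc) r)
          (northWest-marginals π (tail μ) r)

  marginals-northWest : ∀ {a b k} (π : Staircase a b k) {x y} → Balanced x y →
                        marginalˣ π (northWest π x y) ≗ x × marginalʸ π (northWest π x y) ≗ y
  marginals-northWest corner {x} {y} bal =
    (λ { zero → marginalˣ-corner x }) ,
    (λ { zero → trans (marginalʸ-corner x) (balanced-singleton {x = x} {y} bal) })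
  marginals-northWest (right {k = k} π) {x} {y} bal =
    (λ { zero → marginalˣ-right π ν zero ; (suc p) → trans (marginalˣ-right π ν (suc p)) (proj₁ ih p) }) ,
    (λ q → trans (marginalʸ-right π ν q) (updateAt-−-+ (proj₂ ih) q))
    where
    ν : Fin (suc (suc k)) → ℚ
    ν = northWest (right π) x y
    ih : marginalˣ π (tail ν) ≗ tail x × marginalʸ π (tail ν) ≗ updateAt y zero (_- head x)
    ih = marginals-northWest π (balanced-right {x = x} {y} bal)
  marginals-northWest (up {k = k} π) {x} {y} bal =
    (λ p → trans (marginalˣ-up π ν p) (updateAt-−-+ (proj₁ ih) p)) ,
    (λ { zero → marginalʸ-up π ν zero ; (suc q) → trans (marginalʸ-up π ν (suc q)) (proj₂ ih q) })
    where
    ν : Fin (suc (suc k)) → ℚ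
    ν = northWest (up π) x y
    ih : marginalˣ π (tail ν) ≗ updateAt x zero (_- head y) × marginalʸ π (tail ν) ≗ tail y
    ih = marginals-northWest π (balanced-up {x = x} {y} bal)

  sum-northWest : ∀ {a b k} (π : Staircase a b k) x y → sumℚ (northWest π x y) ≡ sumℚ x
  sum-northWest corner    x y = refl
  sum-northWest (right π) x y = cong (head x +_) (sum-northWest π (tail x) _)
  sum-northWest (up π)    x y = trans (cong (head y +_) (sum-northWest π _ (tail y)))
    (solve 3 (λ y₀ x₀ s → y₀ :+ ((x₀ :- y₀) :+ s) := x₀ :+ s) refl (head y) (head x) _)

  sum-marginalˣ : ∀ {a b k} (π : Staircase a b k) μ → sumℚ (marginalˣ π μ) ≡ sumℚ μ
  sum-marginalˣ π μ = trans (sym (sum-northWest π _ _)) (sumℚ-cong (northWest-marginals π μ))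

  private
    sumℚ-updateAt-+ : ∀ {m} (g : Fin (suc m) → ℚ) c → sumℚ (updateAt g zero (c +_)) ≡ c + sumℚ g
    sumℚ-updateAt-+ g c = ℚₚ.+-assoc c (g zero) _

  marginals-balanced : ∀ {a b k} (π : Staircase a b k) μ → Balanced (marginalˣ π μ) (marginalʸ π μ)
  marginals-balanced corner    μ = refl
  marginals-balanced (right π) μ = begin
    sumℚ (marginalˣ (right π) μ)                               ≡⟨ sumℚ-cong (marginalˣ-right π μ) ⟩
    head μ + sumℚ (marginalˣ π (tail μ))                       ≡⟨ cong (head μ +_) (marginals-balanced π (tail μ)) ⟩
    head μ + sumℚ (marginalʸ π (tail μ))                       ≡⟨ sumℚ-updateAt-+ (marginalʸ π (tail μ)) (head μ) ⟨
    sumℚ (updateAt (marginalʸ π (tail μ)) zero (head μ +_))    ≡⟨ sumℚ-cong (marginalʸ-right π μ) ⟨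
    sumℚ (marginalʸ (right π) μ)                               ∎
    where open ≡-Reasoning
  marginals-balanced (up π)    μ = begin
    sumℚ (marginalˣ (up π) μ)                                  ≡⟨ sumℚ-cong (marginalˣ-up π μ) ⟩
    sumℚ (updateAt (marginalˣ π (tail μ)) zero (head μ +_))    ≡⟨ sumℚ-updateAt-+ (marginalˣ π (tail μ)) (head μ) ⟩
    head μ + sumℚ (marginalˣ π (tail μ))                       ≡⟨ cong (head μ +_) (marginals-balanced π (tail μ)) ⟩
    head μ + sumℚ (marginalʸ π (tail μ))                       ≡⟨ sumℚ-cong (marginalʸ-up π μ) ⟨
    sumℚ (marginalʸ (up π) μ)                                  ∎
    where open ≡-Reasoning

  northWest-integral : ∀ {a b k} (π : Staircase a b k) {x y} → (∀ p → Integral (x p)) → (∀ q → Integral (y q)) →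
                       ∀ r → Integral (northWest π x y r)
  northWest-integral corner    ix iy r       = ix r
  northWest-integral (right π) ix iy zero    = ix zero
  northWest-integral (right π) ix iy (suc r) =
    northWest-integral π (ix ∘ suc) (λ { zero → integral-- (iy zero) (ix zero) ; (suc q) → iy (suc q) }) r
  northWest-integral (up π)    ix iy zero    = iy zero
  northWest-integral (up π)    ix iy (suc r) =
    northWest-integral π (λ { zero → integral-- (ix zero) (iy zero) ; (suc p) → ix (suc p) }) (iy ∘ suc) r

  private
    0<q-p⇒p<q : ∀ {p q} → 0ℚ < q - p → p < q
    0<q-p⇒p<q {p} {q} h = subst₂ _<_ (ℚₚ.+-identityˡ p) (solve 2 (λ p q → (q :- p) :+ p := q) refl p q)
                                 (ℚₚ.+-monoˡ-< p h)

    p≤q⇒0≤q-p : ∀ {p q} → p ≤ q → 0ℚ ≤ q - p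
    p≤q⇒0≤q-p {p} {q} h = subst (_≤ q - p) (ℚₚ.+-inverseʳ p) (ℚₚ.+-monoˡ-≤ (- p) h)

  positive-heads : ∀ {a b k} (π : Staircase a b k) {x y} → Balanced x y → (∀ r → 0ℚ < northWest π x y r) →
                   0ℚ < head x × 0ℚ < head y
  positive-heads corner {x} {y} bal pos = pos zero , subst (0ℚ <_) (balanced-singleton {x = x} {y} bal) (pos zero)
  positive-heads (right π) {x} {y} bal pos =
    pos zero , ℚₚ.<-trans (pos zero) (0<q-p⇒p<q (proj₂ (positive-heads π (balanced-right {x = x} {y} bal) (pos ∘ suc))))
  positive-heads (up π) {x} {y} bal pos =
    ℚₚ.<-trans (pos zero) (0<q-p⇒p<q (proj₁ (positive-heads π (balanced-up {x = x} {y} bal) (pos ∘ suc)))) , pos zero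

  positive-unique : ∀ {a b k} (π π′ : Staircase a b k) {x y} → Balanced x y →
                    (∀ r → 0ℚ < northWest π x y r) → (∀ r → 0ℚ < northWest π′ x y r) → π ≡ π′
  positive-unique corner    corner     bal pos pos′ = refl
  positive-unique (right π) (right π′) {x} {y} bal pos pos′ =
    cong right (positive-unique π π′ (balanced-right {x = x} {y} bal) (pos ∘ suc) (pos′ ∘ suc))
  positive-unique (up π)    (up π′)    {x} {y} bal pos pos′ =
    cong up (positive-unique π π′ (balanced-up {x = x} {y} bal) (pos ∘ suc) (pos′ ∘ suc))
  positive-unique (right π) (up π′)    {x} {y} bal pos pos′ = ⊥-elim (ℚₚ.<-asym
    (0<q-p⇒p<q {head x} {head y} (proj₂ (positive-heads π  (balanced-right {x = x} {y} bal) (pos ∘ suc))))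
    (0<q-p⇒p<q {head y} {head x} (proj₁ (positive-heads π′ (balanced-up {x = x} {y} bal) (pos′ ∘ suc)))))
  positive-unique (up π)    (right π′) bal pos pos′ = sym (positive-unique (right π′) (up π) bal pos′ pos)

  private
    residual-nonneg : ∀ {m} {x : Fin m → ℚ} {c} → (∀ p → 0ℚ ≤ x p) → sumℚ x ≡ c + 0ℚ → 0ℚ ≤ c
    residual-nonneg {x = x} x≥0 eq = subst (0ℚ ≤_) (trans eq (ℚₚ.+-identityʳ _)) (sumℚ-nonneg x x≥0)

  feasibleStaircase : ∀ a b k → k ≡ a ℕ.+ b → ∀ {x y} →
                      (∀ p → 0ℚ ≤ x p) → (∀ q → 0ℚ ≤ y q) → Balanced x y →
                      Σ[ π ∈ Staircase a b k ] (∀ r → 0ℚ ≤ northWest π x y r)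
  feasibleStaircase zero    zero    zero    refl x≥0 y≥0 bal = corner , x≥0
  feasibleStaircase (suc a) zero    (suc k) eq   {x} {y} x≥0 y≥0 bal =
    let π , ν≥0 = feasibleStaircase a zero k (ℕₚ.suc-injective eq) (x≥0 ∘ suc)
                    (λ { zero → residual-nonneg (x≥0 ∘ suc) bal′ }) bal′
    in right π , λ { zero → x≥0 zero ; (suc r) → ν≥0 r }
    where
    bal′ : Balanced (tail x) (updateAt y zero (_- head x))
    bal′ = balanced-right {x = x} {y} bal
  feasibleStaircase zero    (suc b) (suc k) eq   {x} {y} x≥0 y≥0 bal =
    let π , ν≥0 = feasibleStaircase zero b k (ℕₚ.suc-injective eq)
                    (λ { zero → residual-nonneg (y≥0 ∘ suc) (sym bal′) }) (y≥0 ∘ suc) bal′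
    in up π , λ { zero → y≥0 zero ; (suc r) → ν≥0 r }
    where
    bal′ : Balanced (updateAt x zero (_- head y)) (tail y)
    bal′ = balanced-up {x = x} {y} bal
  feasibleStaircase (suc a) (suc b) (suc k) eq   {x} {y} x≥0 y≥0 bal with head x ℚₚ.≤? head y
  ... | yes x₀≤y₀ =
    let π , ν≥0 = feasibleStaircase a (suc b) k (ℕₚ.suc-injective eq) (x≥0 ∘ suc)
                    (λ { zero → p≤q⇒0≤q-p x₀≤y₀ ; (suc q) → y≥0 (suc q) }) (balanced-right {x = x} {y} bal)
    in right π , λ { zero → x≥0 zero ; (suc r) → ν≥0 r }
  ... | no  x₀≰y₀ =
    let π , ν≥0 = feasibleStaircase (suc a) b k (trans (ℕₚ.suc-injective eq) (ℕₚ.+-suc a b))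
                    (λ { zero → p≤q⇒0≤q-p (ℚₚ.<⇒≤ (ℚₚ.≰⇒> x₀≰y₀)) ; (suc p) → x≥0 (suc p) })
                    (y≥0 ∘ suc) (balanced-up {x = x} {y} bal)
    in up π , λ { zero → y≥0 zero ; (suc r) → ν≥0 r }

module StaircaseEnumeration where

  open Staircase
  open import Data.Nat using (_+_; _*_)
  open import Data.Nat.DivMod using (_/_; m*n/n≡m)
  open import Data.Nat.Properties using (_!≢0)
  open import Data.Nat.Solver using (module +-*-Solver)
  open +-*-Solver
  open import Data.List using ([]; _∷_; _++_; map)
  import Data.List.Properties as Listₚ
  open import Data.List.Membership.Propositional using (_∈_)
  open import Data.List.Membership.Propositional.Properties using (∈-map⁺; ∈-map⁻; ∈-++⁺ˡ; ∈-++⁺ʳ)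
  open import Data.List.Relation.Unary.Any using (here)
  open import Data.List.Relation.Unary.All using ([])
  open import Data.List.Relation.Unary.AllPairs using ([]; _∷_)
  open import Data.List.Relation.Unary.Unique.Propositional using (Unique)
  import Data.List.Relation.Unary.Unique.Propositional.Properties as Uniqueₚ

  staircases : ∀ a b k → List (Staircase a b k)
  staircases zero    zero    zero    = corner ∷ []
  staircases (suc a) zero    (suc k) = map right (staircases a zero k)
  staircases zero    (suc b) (suc k) = map up (staircases zero b k)
  staircases (suc a) (suc b) (suc k) = map right (staircases a (suc b) k) ++ map up (staircases (suc a) b k)
  staircases _       _       _       = []

  staircases-complete : ∀ {a b k} (π : Staircase a b k) → π ∈ staircases a b k
  staircases-complete corner                  = here refl
  staircases-complete (right {b = zero} π)    = ∈-map⁺ right (staircases-complete π)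
  staircases-complete (right {b = suc b} π)   = ∈-++⁺ˡ (∈-map⁺ right (staircases-complete π))
  staircases-complete (up {a = zero} π)       = ∈-map⁺ up (staircases-complete π)
  staircases-complete (up {a = suc a} {b} {k} π) =
    ∈-++⁺ʳ (map right (staircases a (suc b) k)) (∈-map⁺ up (staircases-complete π))

  private
    right-injective : ∀ {a b k} {π π′ : Staircase a b k} → right π ≡ right π′ → π ≡ π′
    right-injective refl = refl

    up-injective : ∀ {a b k} {π π′ : Staircase a b k} → up π ≡ up π′ → π ≡ π′
    up-injective refl = refl

  staircases-unique : ∀ a b k → Unique (staircases a b k)
  staircases-unique zero    zero    zero    = [] ∷ []
  staircases-unique (suc a) zero    (suc k) = Uniqueₚ.map⁺ right-injective (staircases-unique a zero k)
  staircases-unique zero    (suc b) (suc k) = Uniqueₚ.map⁺ up-injective (staircases-unique zero b k)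
  staircases-unique (suc a) (suc b) (suc k) = Uniqueₚ.++⁺ (Uniqueₚ.map⁺ right-injective (staircases-unique a (suc b) k))
    (Uniqueₚ.map⁺ up-injective (staircases-unique (suc a) b k)) right≢up
    where
    right≢up : ∀ {π} → ¬ (π ∈ map right (staircases a (suc b) k) × π ∈ map up (staircases (suc a) b k))
    right≢up (∈right , ∈up) with ∈-map⁻ right ∈right | ∈-map⁻ up ∈up
    ... | _ , _ , refl | _ , _ , ()
  staircases-unique (suc a) zero    zero    = []
  staircases-unique zero    (suc b) zero    = []
  staircases-unique zero    zero    (suc k) = []
  staircases-unique (suc a) (suc b) zero    = []

  rising-shift : ∀ k b → rising k (suc b) ≡ k * rising (suc k) b
  rising-shift k zero    = solve 1 (λ k → con 1 :* (k :+ con 0) := k :* con 1) refl k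
  rising-shift k (suc b) = begin
    rising k (suc b) * (k + suc b)          ≡⟨ cong (_* (k + suc b)) (rising-shift k b) ⟩
    k * rising (suc k) b * (k + suc b)      ≡⟨ solve 3 (λ k R b → k :* R :* (k :+ (con 1 :+ b))
                                                                := k :* (R :* ((con 1 :+ k) :+ b)))
                                                 refl k (rising (suc k) b) b ⟩
    k * (rising (suc k) b * (suc k + b))    ∎
    where open ≡-Reasoning

  rising-pascal : ∀ k b → rising (suc k) (suc b) ≡ rising k (suc b) + suc b * rising (suc k) b
  rising-pascal k b = begin
    rising (suc k) b * (suc k + b)                 ≡⟨ solve 3 (λ k R b → R :* ((con 1 :+ k) :+ b) := k :* R :+ (con 1 :+ b) :* R)
                                                        refl k (rising (suc k) b) b ⟩
    k * rising (suc k) b + suc b * rising (suc k) b  ≡⟨ cong (_+ suc b * rising (suc k) b) (rising-shift k b) ⟨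
    rising k (suc b) + suc b * rising (suc k) b    ∎
    where open ≡-Reasoning

  staircases-count : ∀ a b k → k ≡ a + b → length (staircases a b k) * b ! ≡ rising (suc a) b
  staircases-count zero    zero    zero    eq = refl
  staircases-count (suc a) zero    (suc k) eq =
    trans (cong (_* 1) (Listₚ.length-map right (staircases a zero k))) (staircases-count a zero k (ℕₚ.suc-injective eq))
  staircases-count zero    (suc b) (suc k) eq = begin
    length (map up L) * (suc b * b !)   ≡⟨ cong (_* (suc b * b !)) (Listₚ.length-map up L) ⟩
    length L * (suc b * b !)            ≡⟨ solve 3 (λ l b f → l :* ((con 1 :+ b) :* f) := l :* f :* (con 1 :+ b))
                                                    refl (length L) b (b !) ⟩
    length L * b ! * suc b              ≡⟨ cong (_* suc b) (staircases-count zero b k (ℕₚ.suc-injective eq)) ⟩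
    rising 1 b * suc b                  ∎
    where
    open ≡-Reasoning
    L : List (Staircase zero b k)
    L = staircases zero b k
  staircases-count (suc a) (suc b) (suc k) eq = begin
    length (map right L₁ ++ map up L₂) * (suc b * b !)
      ≡⟨ cong (_* (suc b * b !)) (trans (Listₚ.length-++ (map right L₁))
                                        (cong₂ _+_ (Listₚ.length-map right L₁) (Listₚ.length-map up L₂))) ⟩
    (length L₁ + length L₂) * (suc b * b !)
      ≡⟨ solve 4 (λ l₁ l₂ b f → (l₁ :+ l₂) :* ((con 1 :+ b) :* f)
                                  := l₁ :* ((con 1 :+ b) :* f) :+ (con 1 :+ b) :* (l₂ :* f))
                 refl (length L₁) (length L₂) b (b !) ⟩
    length L₁ * (suc b * b !) + suc b * (length L₂ * b !)
      ≡⟨ cong₂ (λ u v → u + suc b * v) (staircases-count a (suc b) k (ℕₚ.suc-injective eq))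
                                       (staircases-count (suc a) b k (trans (ℕₚ.suc-injective eq) (ℕₚ.+-suc a b))) ⟩
    rising (suc a) (suc b) + suc b * rising (suc (suc a)) b
      ≡⟨ rising-pascal (suc a) b ⟨
    rising (suc (suc a)) (suc b) ∎
    where
    open ≡-Reasoning
    L₁ : List (Staircase a (suc b) k)
    L₁ = staircases a (suc b) k
    L₂ : List (Staircase (suc a) b k)
    L₂ = staircases (suc a) b k

  risingOverFact≡#staircases : ∀ a b → risingOverFact (suc a) b ≡ length (staircases a b (a + b))
  risingOverFact≡#staircases a b = trans (cong (λ m → (m / b !) {{b !≢0}}) (sym (staircases-count a b (a + b) refl)))
                                         (m*n/n≡m (length (staircases a b (a + b))) (b !) {{b !≢0}})

-- The graph G[j+1](c) for c = suc ∘ a, so that the in-edges of each middle vertex i are indexed by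
-- Fin (suc (a i)), the columns of the staircases of the block i.
module FlowGraph (n : ℕ) (a j : Fin n → ℕ) where

  open RationalSums
  open Blocks
  open Staircase using (Balanced)
  open import Data.Rational using (_+_; _-_; _*_; -_)
  open import Data.Rational.Solver using (module +-*-Solver)
  open +-*-Solver
  open import Data.List using (_++_; replicate; allFin)
  import Data.List.Properties as Listₚ
  import Data.Sum as Sum
  open import Data.Fin.Relation.Unary.Top using (view; ‵fromℕ; ‵inject₁)

  V : ℕ
  V = suc (suc n)

  source sink : Fin V
  source = zero
  sink   = fromℕ (suc n)

  mid : Fin n → Fin V
  mid i = suc (inject₁ i)

  private
    inBundle : Fin n → Graph V
    inBundle i = replicate (suc (a i)) (source , mid i)

    outBundle : Fin n → Graph V
    outBundle i = replicate (suc (j i)) (mid i , sink)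

    #inBundle : ∀ i → length (inBundle i) ≡ suc (a i)
    #inBundle i = Listₚ.length-replicate (suc (a i))

    #outBundle : ∀ i → length (outBundle i) ≡ suc (j i)
    #outBundle i = Listₚ.length-replicate (suc (j i))

  edgeBlock : Fin n → Graph V
  edgeBlock i = inBundle i ++ outBundle i

  G : Graph V
  G = concatBlocks edgeBlock

  G[j+1]≡G : ∀ {c} → (∀ i → c i ≡ suc (a i)) → G[j+1] n j c ≡ G
  G[j+1]≡G c≡suc-a =
    trans (Listₚ.concatMap-cong (λ i → cong (λ m → replicate m _ ++ replicate (suc (j i)) _) (c≡suc-a i)) (allFin n))
          (concatMap-tabulate edgeBlock id)

  inEdge : (i : Fin n) → Fin (suc (a i)) → Edge G
  inEdge i k = embedConcat edgeBlock i (inˡ (inBundle i) (outBundle i) (Fin.cast (sym (#inBundle i)) k))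

  outEdge : (i : Fin n) → Fin (suc (j i)) → Edge G
  outEdge i l = embedConcat edgeBlock i (inʳ (inBundle i) (outBundle i) (Fin.cast (sym (#outBundle i)) l))

  Label : Set
  Label = Σ[ i ∈ Fin n ] (Fin (suc (a i)) ⊎ Fin (suc (j i)))

  label : Edge G → Label
  label e = let i , p = splitConcat edgeBlock e in
            i , Sum.map (Fin.cast (#inBundle i)) (Fin.cast (#outBundle i)) (side (inBundle i) (outBundle i) p)

  label-inEdge : ∀ i k → label (inEdge i k) ≡ (i , inj₁ k)
  label-inEdge i k rewrite splitConcat-embedConcat edgeBlock i (inˡ (inBundle i) (outBundle i) (Fin.cast (sym (#inBundle i)) k))
                         | side-inˡ (inBundle i) (outBundle i) (Fin.cast (sym (#inBundle i)) k)
                         | Finₚ.cast-involutive (#inBundle i) (sym (#inBundle i)) k = refl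

  label-outEdge : ∀ i l → label (outEdge i l) ≡ (i , inj₂ l)
  label-outEdge i l rewrite splitConcat-embedConcat edgeBlock i (inʳ (inBundle i) (outBundle i) (Fin.cast (sym (#outBundle i)) l))
                          | side-inʳ (inBundle i) (outBundle i) (Fin.cast (sym (#outBundle i)) l)
                          | Finₚ.cast-involutive (#outBundle i) (sym (#outBundle i)) l = refl

  edge-elim : (P : Edge G → Set) → (∀ i k → P (inEdge i k)) → (∀ i l → P (outEdge i l)) → ∀ e → P e
  edge-elim P Pin Pout e = subst P (embedConcat-splitConcat edgeBlock e) (inBlock (proj₁ (splitConcat edgeBlock e)) _)
    where
    inBlock : ∀ i p → P (embedConcat edgeBlock i p)
    inBlock i p with side (inBundle i) (outBundle i) p | in-side (inBundle i) (outBundle i) p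
    ... | inj₁ q | eq = subst (P ∘ embedConcat edgeBlock i)
                          (trans (cong (inˡ (inBundle i) (outBundle i))
                                       (Finₚ.cast-involutive (sym (#inBundle i)) (#inBundle i) q)) eq)
                          (Pin i (Fin.cast (#inBundle i) q))
    ... | inj₂ q | eq = subst (P ∘ embedConcat edgeBlock i)
                          (trans (cong (inʳ (inBundle i) (outBundle i))
                                       (Finₚ.cast-involutive (sym (#outBundle i)) (#outBundle i) q)) eq)
                          (Pout i (Fin.cast (#outBundle i) q))

  lookup-inEdge : ∀ i k → lookup G (inEdge i k) ≡ (source , mid i)
  lookup-inEdge i k = trans (lookup-embedConcat edgeBlock i (inˡ (inBundle i) (outBundle i) p))
    (trans (lookup-inˡ (inBundle i) (outBundle i) p) (Listₚ.lookup-replicate (suc (a i)) _ k))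
    where
    p : Fin (length (inBundle i))
    p = Fin.cast (sym (#inBundle i)) k

  lookup-outEdge : ∀ i l → lookup G (outEdge i l) ≡ (mid i , sink)
  lookup-outEdge i l = trans (lookup-embedConcat edgeBlock i (inʳ (inBundle i) (outBundle i) q))
    (trans (lookup-inʳ (inBundle i) (outBundle i) q) (Listₚ.lookup-replicate (suc (j i)) _ l))
    where
    q : Fin (length (outBundle i))
    q = Fin.cast (sym (#outBundle i)) l

  sumℚ-edges : (f : Edge G → ℚ) → sumℚ f ≡ sumℚ (λ i → sumℚ (f ∘ inEdge i) + sumℚ (f ∘ outEdge i))
  sumℚ-edges f = trans (sumℚ-concat edgeBlock f) (sumℚ-cong λ i →
    trans (sumℚ-++ (inBundle i) (outBundle i) (f ∘ embedConcat edgeBlock i))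
          (cong₂ _+_ (sumℚ-cast (sym (#inBundle i)) (f ∘ embedConcat edgeBlock i ∘ inˡ (inBundle i) (outBundle i)))
                     (sumℚ-cast (sym (#outBundle i)) (f ∘ embedConcat edgeBlock i ∘ inʳ (inBundle i) (outBundle i)))))

  inflow : (Edge G → ℚ) → Fin n → ℚ
  inflow f i = sumℚ (f ∘ inEdge i)

  outflow : (Edge G → ℚ) → Fin n → ℚ
  outflow f i = sumℚ (f ∘ outEdge i)

  private
    mid≢sink : ∀ i → mid i ≢ sink
    mid≢sink i eq = Finₚ.fromℕ≢inject₁ (sym (Finₚ.suc-injective eq))

    mid-injective : ∀ {i i′} → mid i ≡ mid i′ → i ≡ i′
    mid-injective = Finₚ.inject₁-injective ∘ Finₚ.suc-injective

  incidence-cong : ∀ {f g : Edge G → ℚ} → f ≗ g → ∀ v → incidence G f v ≡ incidence G g v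
  incidence-cong f≗g v = sumℚ-cong (λ e → cong (_* (δ (src G e) v - δ (tgt G e) v)) (f≗g e))

  incidence-G : ∀ f v → incidence G f v ≡
                sumℚ (λ i → inflow f i * (δ source v - δ (mid i) v) + outflow f i * (δ (mid i) v - δ sink v))
  incidence-G f v = trans (sumℚ-edges _) (sumℚ-cong λ i → cong₂ _+_
    (trans (sumℚ-cong λ k → cong (λ e → f (inEdge i k) * (δ (proj₁ e) v - δ (proj₂ e) v)) (lookup-inEdge i k))
           (sumℚ-*ʳ (f ∘ inEdge i) _))
    (trans (sumℚ-cong λ l → cong (λ e → f (outEdge i l) * (δ (proj₁ e) v - δ (proj₂ e) v)) (lookup-outEdge i l))
           (sumℚ-*ʳ (f ∘ outEdge i) _)))

  incidence-source : ∀ f → incidence G f source ≡ sumℚ (inflow f)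
  incidence-source f = trans (incidence-G f source) (sumℚ-cong λ i →
    solve 2 (λ x y → x :* (con 1ℚ :- con 0ℚ) :+ y :* (con 0ℚ :- con 0ℚ) := x) refl (inflow f i) (outflow f i))

  incidence-mid : ∀ f i → incidence G f (mid i) ≡ outflow f i - inflow f i
  incidence-mid f i = begin
    incidence G f (mid i)
      ≡⟨ incidence-G f (mid i) ⟩
    sumℚ (λ i′ → inflow f i′ * (0ℚ - δ (mid i′) (mid i)) + outflow f i′ * (δ (mid i′) (mid i) - δ sink (mid i)))
      ≡⟨ sumℚ-single _ i (λ i′ i′≢i → trans (cong₂ (λ u w → inflow f i′ * (0ℚ - u) + outflow f i′ * (u - w))
                                                   (δ-≢ (i′≢i ∘ mid-injective)) (δ-≢ (mid≢sink i ∘ sym)))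
                                             (solve 2 (λ x y → x :* (con 0ℚ :- con 0ℚ) :+ y :* (con 0ℚ :- con 0ℚ) := con 0ℚ)
                                                    refl (inflow f i′) (outflow f i′))) ⟩
    inflow f i * (0ℚ - δ (mid i) (mid i)) + outflow f i * (δ (mid i) (mid i) - δ sink (mid i))
      ≡⟨ cong₂ (λ u w → inflow f i * (0ℚ - u) + outflow f i * (u - w)) (δ-refl (mid i)) (δ-≢ (mid≢sink i ∘ sym)) ⟩
    inflow f i * (0ℚ - 1ℚ) + outflow f i * (1ℚ - 0ℚ)
      ≡⟨ solve 2 (λ x y → x :* (con 0ℚ :- con 1ℚ) :+ y :* (con 1ℚ :- con 0ℚ) := y :- x)
                 refl (inflow f i) (outflow f i) ⟩
    outflow f i - inflow f i ∎
    where open ≡-Reasoning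

  incidence-sink : ∀ f → incidence G f sink ≡ - sumℚ (outflow f)
  incidence-sink f = trans (incidence-G f sink) (trans (sumℚ-cong λ i →
    trans (cong₂ (λ u w → inflow f i * (0ℚ - u) + outflow f i * (u - w)) (δ-≢ (mid≢sink i)) (δ-refl sink))
          (solve 2 (λ x y → x :* (con 0ℚ :- con 0ℚ) :+ y :* (con 0ℚ :- con 1ℚ) := :- y) refl (inflow f i) (outflow f i)))
    (sumℚ-neg (outflow f)))

  private
    netflow-mid : ∀ i → e₁-eₙ₊₂ n (mid i) ≡ 0ℚ
    netflow-mid i with mid i ≟ sink
    ... | yes eq = ⊥-elim (mid≢sink i eq)
    ... | no  _  = refl

    netflow-sink : e₁-eₙ₊₂ n sink ≡ - 1ℚ
    netflow-sink with sink ≟ sink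
    ... | yes _   = refl
    ... | no  s≢s = ⊥-elim (s≢s refl)

  IsUnitFlow : (Edge G → ℚ) → Set
  IsUnitFlow f = sumℚ (inflow f) ≡ 1ℚ × (∀ i → Balanced (f ∘ inEdge i) (f ∘ outEdge i))

  netflow⇒unitFlow : ∀ f → (∀ v → incidence G f v ≡ e₁-eₙ₊₂ n v) → IsUnitFlow f
  netflow⇒unitFlow f conserved = trans (sym (incidence-source f)) (conserved source) , λ i → sym (begin
    outflow f i                      ≡⟨ solve 2 (λ x y → y := (y :- x) :+ x) refl (inflow f i) (outflow f i) ⟩
    (outflow f i - inflow f i) + inflow f i  ≡⟨ cong (_+ inflow f i) (trans (sym (incidence-mid f i))
                                                                           (trans (conserved (mid i)) (netflow-mid i))) ⟩
    0ℚ + inflow f i                  ≡⟨ ℚₚ.+-identityˡ _ ⟩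
    inflow f i                       ∎)
    where open ≡-Reasoning

  unitFlow⇒netflow : ∀ f → IsUnitFlow f → ∀ v → incidence G f v ≡ e₁-eₙ₊₂ n v
  unitFlow⇒netflow f (total , balanced) zero = trans (incidence-source f) total
  unitFlow⇒netflow f (total , balanced) (suc w) with view w
  ... | ‵fromℕ     = trans (incidence-sink f) (trans (cong -_ (trans (sumℚ-cong (sym ∘ balanced)) total)) (sym netflow-sink))
  ... | ‵inject₁ i = trans (incidence-mid f i) (trans (cong (_- inflow f i) (sym (balanced i)))
                                                     (trans (ℚₚ.+-inverseʳ (inflow f i)) (sym (netflow-mid i))))

module Triangulation (n′ : ℕ) (a j : Fin (suc n′) → ℕ) where

  open RationalSums
  open Staircase
  open Tuples
  open StaircaseEnumeration
  open Blocks
  open FlowGraph (suc n′) a j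
  open import Data.Rational using (_+_; _*_; _≤_; _<_)
  open import Data.List using (map)
  import Data.List.Properties as Listₚ
  open import Data.List.Relation.Unary.Any as Any using ()
  open import Data.List.Relation.Unary.Any.Properties using (lookup-index)
  open import Data.List.Membership.Propositional using (_∈_)
  open import Data.List.Relation.Unary.Unique.Propositional using (Unique)
  import Data.Sum as Sum
  open import Data.Product using (uncurry)

  n : ℕ
  n = suc n′

  size : Fin n → ℕ
  size i = suc (a i ℕ.+ j i)

  -- suc d reduces to sumℕ size, the number of nodes of a tuple of staircases, only because n = suc n′.
  d : ℕ
  d = (a zero ℕ.+ j zero) ℕ.+ sumℕ (size ∘ suc)

  Staircases : Set
  Staircases = Tuple n (λ i → Staircase (a i) (j i) (a i ℕ.+ j i))

  stair : Staircases → (i : Fin n) → Staircase (a i) (j i) (a i ℕ.+ j i)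
  stair = component

  -- The vertex at node r of the staircase of block i: one unit of flow along in-edge col r and
  -- out-edge row r of the middle vertex i.
  blockFlow : Staircases → (i : Fin n) → Fin (size i) → Fin (suc (a i)) ⊎ Fin (suc (j i)) → ℤ
  blockFlow t i r = Sum.[ δℤ (col (stair t i) r) , δℤ (row (stair t i) r) ]′

  nodeFlow : Staircases → Σ[ i ∈ Fin n ] Fin (size i) → Label → ℤ
  nodeFlow t (i , r) (i′ , e) with i ≟ i′
  ... | yes refl = blockFlow t i r e
  ... | no  _    = ℤ.0ℤ

  nodeFlow-same : ∀ t i r e → nodeFlow t (i , r) (i , e) ≡ blockFlow t i r e
  nodeFlow-same t i r e with i ≟ i
  ... | yes refl = refl
  ... | no  i≢i  = ⊥-elim (i≢i refl)

  nodeFlow-other : ∀ t {i i′} r e → i ≢ i′ → nodeFlow t (i , r) (i′ , e) ≡ ℤ.0ℤ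
  nodeFlow-other t {i} {i′} r e i≢i′ with i ≟ i′
  ... | yes i≡i′ = ⊥-elim (i≢i′ i≡i′)
  ... | no  _    = refl

  simplex : Staircases → LatticeSimplex (length G) d
  simplex t v e = nodeFlow t (splitBlocks size v) (label e)

  comb-label : ∀ t λ′ {e i} lab → label e ≡ (i , lab) →
               comb (simplex t) λ′ e ≡ sumℚ (λ r → λ′ (embedBlock size i r) * fromℤ (blockFlow t i r lab))
  comb-label t λ′ {e} {i} lab label≡ = begin
    sumℚ (λ v → λ′ v * flowAt (splitBlocks size v) (label e))
      ≡⟨ cong (λ l → sumℚ (λ v → λ′ v * flowAt (splitBlocks size v) l)) label≡ ⟩
    sumℚ (λ v → λ′ v * flowAt (splitBlocks size v) (i , lab))
      ≡⟨ sumℚ-blocks size (λ v → λ′ v * flowAt (splitBlocks size v) (i , lab)) ⟩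
    sumℚ (λ i′ → sumℚ (λ r → weight i′ r * flowAt (splitBlocks size (embedBlock size i′ r)) (i , lab)))
      ≡⟨ sumℚ-cong (λ i′ → sumℚ-cong λ r → cong (λ w → weight i′ r * flowAt w (i , lab))
                                                (splitBlocks-embedBlock size i′ r)) ⟩
    sumℚ (λ i′ → sumℚ (λ r → weight i′ r * flowAt (i′ , r) (i , lab)))
      ≡⟨ sumℚ-single _ i (λ i′ i′≢i → sumℚ-zero λ r →
           trans (cong (λ z → weight i′ r * fromℤ z) (nodeFlow-other t r lab i′≢i)) (ℚₚ.*-zeroʳ (weight i′ r))) ⟩
    sumℚ (λ r → weight i r * flowAt (i , r) (i , lab))
      ≡⟨ sumℚ-cong (λ r → cong (λ z → weight i r * fromℤ z) (nodeFlow-same t i r lab)) ⟩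
    sumℚ (λ r → weight i r * fromℤ (blockFlow t i r lab)) ∎
    where
    open ≡-Reasoning
    weight : (i′ : Fin n) → Fin (size i′) → ℚ
    weight i′ = λ′ ∘ embedBlock size i′
    flowAt : Σ[ i ∈ Fin n ] Fin (size i) → Label → ℚ
    flowAt w l = fromℤ (nodeFlow t w l)

  comb-inEdge : ∀ t λ′ i → comb (simplex t) λ′ ∘ inEdge i ≗ marginalˣ (stair t i) (λ′ ∘ embedBlock size i)
  comb-inEdge t λ′ i k = comb-label t λ′ {inEdge i k} (inj₁ k) (label-inEdge i k)

  comb-outEdge : ∀ t λ′ i → comb (simplex t) λ′ ∘ outEdge i ≗ marginalʸ (stair t i) (λ′ ∘ embedBlock size i)
  comb-outEdge t λ′ i l = comb-label t λ′ {outEdge i l} (inj₂ l) (label-outEdge i l)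

  blockCoordinates : Staircases → (Edge G → ℚ) → (i : Fin n) → Fin (size i) → ℚ
  blockCoordinates t p i = northWest (stair t i) (p ∘ inEdge i) (p ∘ outEdge i)

  coordinates : Staircases → (Edge G → ℚ) → Fin (suc d) → ℚ
  coordinates t p v = uncurry (blockCoordinates t p) (splitBlocks size v)

  coordinates-embedBlock : ∀ t p i r → coordinates t p (embedBlock size i r) ≡ blockCoordinates t p i r
  coordinates-embedBlock t p i r = cong (uncurry (blockCoordinates t p)) (splitBlocks-embedBlock size i r)

  coordinates-cong : ∀ t {p q} → p ≗ q → coordinates t p ≗ coordinates t q
  coordinates-cong t p≗q v with splitBlocks size v
  ... | i , r = northWest-cong (stair t i) (p≗q ∘ inEdge i) (p≗q ∘ outEdge i) r

  coordinates-zero : ∀ t → coordinates t (const 0ℚ) ≗ const 0ℚ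
  coordinates-zero t v = northWest-zero (stair t (proj₁ (splitBlocks size v))) (proj₂ (splitBlocks size v))

  coordinates-comb : ∀ t λ′ → coordinates t (comb (simplex t) λ′) ≗ λ′
  coordinates-comb t λ′ v = begin
    northWest π (comb (simplex t) λ′ ∘ inEdge i) (comb (simplex t) λ′ ∘ outEdge i) r
      ≡⟨ northWest-cong π (comb-inEdge t λ′ i) (comb-outEdge t λ′ i) r ⟩
    northWest π (marginalˣ π (λ′ ∘ embedBlock size i)) (marginalʸ π (λ′ ∘ embedBlock size i)) r
      ≡⟨ northWest-marginals π (λ′ ∘ embedBlock size i) r ⟩
    λ′ (embedBlock size i r)
      ≡⟨ cong λ′ (embedBlock-splitBlocks size v) ⟩
    λ′ v ∎
    where
    open ≡-Reasoning
    i : Fin n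
    i = proj₁ (splitBlocks size v)
    r : Fin (size i)
    r = proj₂ (splitBlocks size v)
    π : Staircase (a i) (j i) (a i ℕ.+ j i)
    π = stair t i

  simplex-affinelyIndependent : ∀ t → AffinelyIndependent (simplex t)
  simplex-affinelyIndependent t λ′ _ comb≡0 v =
    trans (sym (coordinates-comb t λ′ v)) (trans (coordinates-cong t comb≡0 v) (coordinates-zero t v))

  sum-coordinates : ∀ t p → IsUnitFlow p → sumℚ (coordinates t p) ≡ 1ℚ
  sum-coordinates t p (total , _) = trans (sumℚ-blocks size (coordinates t p)) (trans (sumℚ-cong λ i →
    trans (sumℚ-cong (coordinates-embedBlock t p i)) (sum-northWest (stair t i) _ _)) total)

  comb-coordinates : ∀ t p → IsUnitFlow p → comb (simplex t) (coordinates t p) ≗ p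
  comb-coordinates t p (_ , balanced) = edge-elim (λ e → comb (simplex t) (coordinates t p) e ≡ p e)
    (λ i k → trans (comb-inEdge t (coordinates t p) i k)
                   (trans (marginalˣ-cong (stair t i) (coordinates-embedBlock t p i) k) (proj₁ (marginals i) k)))
    (λ i l → trans (comb-outEdge t (coordinates t p) i l)
                   (trans (marginalʸ-cong (stair t i) (coordinates-embedBlock t p i) l) (proj₂ (marginals i) l)))
    where
    marginals : ∀ i → marginalˣ (stair t i) (blockCoordinates t p i) ≗ p ∘ inEdge i
                    × marginalʸ (stair t i) (blockCoordinates t p i) ≗ p ∘ outEdge i
    marginals i = marginals-northWest (stair t i) (balanced i)

  inflow-comb : ∀ t λ′ i → inflow (comb (simplex t) λ′) i ≡ sumℚ (λ′ ∘ embedBlock size i)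
  inflow-comb t λ′ i = trans (sumℚ-cong (comb-inEdge t λ′ i)) (sum-marginalˣ (stair t i) (λ′ ∘ embedBlock size i))

  comb-unitFlow : ∀ t λ′ → sumℚ λ′ ≡ 1ℚ → IsUnitFlow (comb (simplex t) λ′)
  comb-unitFlow t λ′ sum≡1 =
    trans (sumℚ-cong (inflow-comb t λ′)) (trans (sym (sumℚ-blocks size λ′)) sum≡1) ,
    λ i → trans (sumℚ-cong (comb-inEdge t λ′ i))
                (trans (marginals-balanced (stair t i) (λ′ ∘ embedBlock size i)) (sym (sumℚ-cong (comb-outEdge t λ′ i))))

  vertex-comb : ∀ t v → (fromℤ ∘ simplex t v) ≗ comb (simplex t) (δ v)
  vertex-comb t v e = sym (begin
    sumℚ (λ w → δ v w * x w)   ≡⟨ sumℚ-single _ v (λ w w≢v → trans (cong (_* x w) (δ-≢ (w≢v ∘ sym)))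
                                                                  (ℚₚ.*-zeroˡ (x w))) ⟩
    δ v v * x v               ≡⟨ cong (_* x v) (δ-refl v) ⟩
    1ℚ * x v                  ≡⟨ ℚₚ.*-identityˡ (x v) ⟩
    x v                       ∎)
    where
    open ≡-Reasoning
    x : Fin (suc d) → ℚ
    x w = fromℤ (simplex t w e)

  nodeFlow-nonneg : ∀ t w l → 0ℚ ≤ fromℤ (nodeFlow t w l)
  nodeFlow-nonneg t (i , r) (i′ , inj₁ k) with i ≟ i′
  ... | yes refl = δℤ-nonneg (col (stair t i) r) k
  ... | no  _    = ℚₚ.≤-refl
  nodeFlow-nonneg t (i , r) (i′ , inj₂ l) with i ≟ i′
  ... | yes refl = δℤ-nonneg (row (stair t i) r) l
  ... | no  _    = ℚₚ.≤-refl

  InP : (Edge G → ℚ) → Set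
  InP = InFlowPolytope G (e₁-eₙ₊₂ n)

  vertex-inP : ∀ t v → InP (fromℤ ∘ simplex t v)
  vertex-inP t v = (λ e → nodeFlow-nonneg t (splitBlocks size v) (label e)) ,
                   λ w → trans (incidence-cong (vertex-comb t v) w)
                               (unitFlow⇒netflow (comb (simplex t) (δ v)) (comb-unitFlow t (δ v) (sum-δ v)) w)

  inP⇒inConv : ∀ t p → InP p → (∀ v → 0ℚ ≤ coordinates t p v) → InConv (simplex t) p
  inP⇒inConv t p (_ , conserved) nonneg =
    coordinates t p , nonneg , sum-coordinates t p unitFlow , comb-coordinates t p unitFlow
    where
    unitFlow : IsUnitFlow p
    unitFlow = netflow⇒unitFlow p conserved

  inP⇒inAff : ∀ t p → InP p → InAff (simplex t) p
  inP⇒inAff t p (_ , conserved) = coordinates t p , sum-coordinates t p unitFlow , comb-coordinates t p unitFlow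
    where
    unitFlow : IsUnitFlow p
    unitFlow = netflow⇒unitFlow p conserved

  simplex-unimodular : ∀ t → Unimodular (simplex t)
  simplex-unimodular t = simplex-affinelyIndependent t , integralWeights
    where
    integralWeights : ∀ z → InAff (simplex t) (fromℤ ∘ z) →
                      ∃[ μ ] (sumℤ μ ≡ ℤ.1ℤ × (∀ x → combℤ (simplex t) μ x ≡ z x))
    integralWeights z (λ′ , sum≡1 , comb≡z) = μ , fromℤ-injective sumμ≡1 , λ x → fromℤ-injective (combμ≡z x)
      where
      integral : ∀ v → Integral (coordinates t (fromℤ ∘ z) v)
      integral v = northWest-integral (stair t (proj₁ (splitBlocks size v))) (λ k → _ , refl) (λ l → _ , refl)
                                      (proj₂ (splitBlocks size v))
      μ : Fin (suc d) → ℤ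
      μ v = proj₁ (integral v)
      λ′≡μ : ∀ v → λ′ v ≡ fromℤ (μ v)
      λ′≡μ v = trans (sym (coordinates-comb t λ′ v)) (trans (coordinates-cong t comb≡z v) (proj₂ (integral v)))
      sumμ≡1 : fromℤ (sumℤ μ) ≡ 1ℚ
      sumμ≡1 = trans (fromℤ-sumℤ μ) (trans (sumℚ-cong (sym ∘ λ′≡μ)) sum≡1)
      combμ≡z : ∀ x → fromℤ (combℤ (simplex t) μ x) ≡ fromℤ (z x)
      combμ≡z x = trans (fromℤ-sumℤ (λ v → μ v ℤ.* simplex t v x))
        (trans (sumℚ-cong λ v → trans (fromℤ-* (μ v) (simplex t v x)) (cong (_* fromℤ (simplex t v x)) (sym (λ′≡μ v))))
               (comb≡z x))

  feasibleTuple : ∀ p → InP p → Σ[ t ∈ Staircases ] (∀ v → 0ℚ ≤ coordinates t p v)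
  feasibleTuple p (nonneg , conserved) =
    t , λ v → blockCoordinates-nonneg (proj₁ (splitBlocks size v)) (proj₂ (splitBlocks size v))
    where
    feasible : ∀ i → Σ[ π ∈ Staircase (a i) (j i) (a i ℕ.+ j i) ]
                         (∀ r → 0ℚ ≤ northWest π (p ∘ inEdge i) (p ∘ outEdge i) r)
    feasible i = feasibleStaircase (a i) (j i) _ refl (nonneg ∘ inEdge i) (nonneg ∘ outEdge i)
                                   (proj₂ (netflow⇒unitFlow p conserved) i)
    t : Staircases
    t = tabulateTuple (proj₁ ∘ feasible)
    blockCoordinates-nonneg : ∀ i r → 0ℚ ≤ blockCoordinates t p i r
    blockCoordinates-nonneg i r = subst (λ π → 0ℚ ≤ northWest π (p ∘ inEdge i) (p ∘ outEdge i) r)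
                                        (sym (component-tabulate (proj₁ ∘ feasible) i)) (proj₂ (feasible i) r)

  relInt-positive : ∀ t p → InRelInt (simplex t) p → ∀ i r → 0ℚ < blockCoordinates t p i r
  relInt-positive t p (λ′ , pos , _ , comb≡p) i r = subst (0ℚ <_) (begin
    λ′ (embedBlock size i r)                                   ≡⟨ coordinates-comb t λ′ (embedBlock size i r) ⟨
    coordinates t (comb (simplex t) λ′) (embedBlock size i r)  ≡⟨ coordinates-cong t comb≡p (embedBlock size i r) ⟩
    coordinates t p (embedBlock size i r)                      ≡⟨ coordinates-embedBlock t p i r ⟩
    blockCoordinates t p i r                                   ∎) (pos (embedBlock size i r))
    where open ≡-Reasoning

  relInt-balanced : ∀ t p → InRelInt (simplex t) p → ∀ i → Balanced (p ∘ inEdge i) (p ∘ outEdge i)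
  relInt-balanced t p (λ′ , _ , sum≡1 , comb≡p) i =
    trans (sumℚ-cong (sym ∘ comb≡p ∘ inEdge i))
          (trans (proj₂ (comb-unitFlow t λ′ sum≡1) i) (sumℚ-cong (comb≡p ∘ outEdge i)))

  relInt-unique : ∀ t t′ p → InRelInt (simplex t) p → InRelInt (simplex t′) p → t ≡ t′
  relInt-unique t t′ p inσ inσ′ = Tuple-ext λ i →
    positive-unique (stair t i) (stair t′ i) (relInt-balanced t p inσ i)
                    (relInt-positive t p inσ i) (relInt-positive t′ p inσ′ i)

  allStaircases : (i : Fin n) → List (Staircase (a i) (j i) (a i ℕ.+ j i))
  allStaircases i = staircases (a i) (j i) (a i ℕ.+ j i)

  simplices : List (LatticeSimplex (length G) d)
  simplices = map simplex (tuples allStaircases)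

  private
    #map : length simplices ≡ length (tuples allStaircases)
    #map = Listₚ.length-map simplex (tuples allStaircases)

  tupleAt : Fin (length simplices) → Staircases
  tupleAt s = lookup (tuples allStaircases) (Fin.cast #map s)

  lookup-simplices : ∀ s → lookup simplices s ≡ simplex (tupleAt s)
  lookup-simplices = lookup-map simplex (tuples allStaircases)

  simplices-complete : ∀ t → ∃[ s ] lookup simplices s ≡ simplex t
  simplices-complete t = s , (begin
    lookup simplices s
      ≡⟨ lookup-simplices s ⟩
    simplex (lookup (tuples allStaircases) (Fin.cast #map s))
      ≡⟨ cong (simplex ∘ lookup (tuples allStaircases)) (Finₚ.cast-involutive #map (sym #map) (Any.index t∈)) ⟩
    simplex (lookup (tuples allStaircases) (Any.index t∈))
      ≡⟨ cong simplex (lookup-index t∈) ⟨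
    simplex t ∎)
    where
    open ≡-Reasoning
    t∈ : t ∈ tuples allStaircases
    t∈ = tuples-complete t (λ i → staircases-complete (stair t i))
    s : Fin (length simplices)
    s = Fin.cast (sym #map) (Any.index t∈)

  tupleAt-injective : ∀ {s s′} → tupleAt s ≡ tupleAt s′ → s ≡ s′
  tupleAt-injective {s} {s′} eq = begin
    s                                  ≡⟨ Finₚ.cast-involutive (sym #map) #map s ⟨
    Fin.cast (sym #map) (Fin.cast #map s)  ≡⟨ cong (Fin.cast (sym #map)) (lookup-injective unique _ _ eq) ⟩
    Fin.cast (sym #map) (Fin.cast #map s′) ≡⟨ Finₚ.cast-involutive (sym #map) #map s′ ⟩
    s′                                 ∎
    where
    open ≡-Reasoning
    unique : Unique (tuples allStaircases)
    unique = tuples-unique (λ i → staircases-unique (a i) (j i) (a i ℕ.+ j i))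

  simplices-dissection : IsDissection InP simplices
  simplices-dissection = record
    { affIndep = λ s → subst AffinelyIndependent (sym (lookup-simplices s)) (simplex-affinelyIndependent (tupleAt s))
    ; vertsInP = λ s k → subst (λ σ → InP (λ x → fromℤ (σ k x))) (sym (lookup-simplices s)) (vertex-inP (tupleAt s) k)
    ; fullDim  = λ s p inP → subst (λ σ → InAff σ p) (sym (lookup-simplices s)) (inP⇒inAff (tupleAt s) p inP)
    ; covers   = covers
    ; disjoint = λ s s′ s≢s′ p (inσ , inσ′) → s≢s′ (tupleAt-injective (relInt-unique (tupleAt s) (tupleAt s′) p
                   (subst (λ σ → InRelInt σ p) (lookup-simplices s) inσ)
                   (subst (λ σ → InRelInt σ p) (lookup-simplices s′) inσ′)))
    }
    where
    covers : ∀ p → InP p → ∃[ s ] InConv (lookup simplices s) p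
    covers p inP = let t , nonneg = feasibleTuple p inP ; s , σₛ≡σₜ = simplices-complete t in
                   s , subst (λ σ → InConv σ p) (sym σₛ≡σₜ) (inP⇒inConv t p inP nonneg)

  simplices-unimodular : ∀ s → Unimodular (lookup simplices s)
  simplices-unimodular s = subst Unimodular (sym (lookup-simplices s)) (simplex-unimodular (tupleAt s))

  #simplices : length simplices ≡ prodℕ (λ i → risingOverFact (suc (a i)) (j i))
  #simplices = trans #map (trans (length-tuples allStaircases)
                                 (prodℕ-cong (λ i → sym (risingOverFact≡#staircases (a i) (j i)))))

  unimodularDissection : UnimodularDissection n G (prodℕ (λ i → risingOverFact (suc (a i)) (j i)))
  unimodularDissection = d , simplices , simplices-dissection , simplices-unimodular , #simplices

open import Data.Nat using (_≤_; _<_)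

lemma3p6 : (n : ℕ) → 1 ≤ n → (c j : Fin n → ℕ) → (∀ i → 0 < c i) →
    ∃[ d ] ∃[ S ] (IsDissection {length (G[j+1] n j c)} {d}
                     (InFlowPolytope (G[j+1] n j c) (e₁-eₙ₊₂ n)) S
                   × (∀ s → Unimodular (lookup S s))
                   × length S ≡ prodℕ (λ i → risingOverFact (c i) (j i)))
lemma3p6 (suc n′) _ c j c>0 =
  subst₂ (UnimodularDissection (suc n′)) (sym (G[j+1]≡G c≡suc-a))
         (sym (Tuples.prodℕ-cong λ i → cong (λ m → risingOverFact m (j i)) (c≡suc-a i)))
         unimodularDissection
  where
  a : Fin (suc n′) → ℕ
  a i = ℕ.pred (c i)
  c≡suc-a : ∀ i → c i ≡ suc (a i)
  c≡suc-a i = sym (ℕₚ.suc-pred (c i) {{ℕ.>-nonZero (c>0 i)}})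
  open FlowGraph (suc n′) a j using (G[j+1]≡G)
  open Triangulation n′ a j using (unimodularDissection)
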